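{- Let $\zeta_1\in wAC(P)$ and $\alpha\in\{0,1\}$. Then in $wAC(P)/\equiv$, $$\overline{[\zeta_1]^{\alpha}}\otimes\overline{[1]}=\overline{[\zeta_1]^{\alpha}}=\overline{[1]}\otimes\overline{[\zeta_1]^{\alpha}}.$$
   Context: $(K,\oplus,\otimes,\hat0,\hat1)$ is a commutative, additively idempotent semiring; $P$ is a finite nonempty set of ports with $0,1\notin P$ and weights $k_p\in K$. $wAI(P)$ is the weighted Algebra of Interactions: terms $z::=0\mid1\mid p\mid z\oplus z\mid z\otimes z\mid(z)$, with semantics $\|z\|(\gamma)\in K$ for $\gamma\in\Gamma(P)=2^{2^P}$: $\|0\|(\gamma)=\hat0$; $\|1\|(\gamma)=\hat1$ iff $\emptyset\in\gamma$ (else $\hat0$); $\|p\|(\gamma)=k_p$ if some $a\in\gamma$ contains $p$ (else $\hat0$); $\|z_1\oplus z_2\|(\gamma)=\bigoplus_{a\in\gamma}(\|z_1\|(\{a\})\oplus\|z_2\|(\{a\}))$; $\|z_1\otimes z_2\|(\gamma)=\bigoplus_{a\in\gamma}\bigoplus_{a_1\cup a_2=a}(\|z_1\|(\{a_1\})\otimes\|z_2\|(\{a_2\}))$ (inner sum over pairs of possibly empty subsets of $P$); $\|(z)\|=\|z\|$. On $wAI(P)$, $z_1\equiv z_2$ iff $\|z_1\|=\|z_2\|$ on all of $\Gamma(P)$; the quotient $wAI(P)/\equiv$ is a commutative idempotent semiring under $\oplus,\otimes$ with zero $\overline0$ and one $\overline1$, and computations with $wAI(P)$ terms are done in it. The weighted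 Algebra of Connectors $wAC(P)$ has syntax: synchrons $\sigma::=[0]\mid[1]\mid[p]\mid[\zeta]$, triggers $\tau::=[0]'\mid[1]'\mid[p]'\mid[\zeta]'$, and $\zeta::=\sigma\mid\tau\mid\zeta\oplus\zeta\mid\zeta\otimes\zeta$, where weighted fusion $\otimes$ is applied to typed connectors; $[\zeta]^{\alpha}$ denotes $[\zeta]$ if $\alpha=0$ and $[\zeta]'$ if $\alpha=1$. The semantics $|\cdot|:wAC(P)\to wAI(P)$ is: $|[p]|=|[p]'|=p$ for $p\in P\cup\{0,1\}$; $|[\zeta]|=|[\zeta]'|=|\zeta|$; $|\zeta_1\oplus\zeta_2|=|\zeta_1|\oplus|\zeta_2|$; $|[\zeta_1]\otimes\cdots\otimes[\zeta_n]|=|\zeta_1|\otimes\cdots\otimes|\zeta_n|$; and if at least one $\alpha_i=1$, $|[\zeta_1]^{\alpha_1}\otimes\cdots\otimes[\zeta_n]^{\alpha_n}|=\bigoplus_{i:\alpha_i=1}\big(|\zeta_i|\otimes\bigotimes_{k\ne i,\alpha_k=1}(1\oplus|\zeta_k|)\otimes\bigotimes_{j:\alpha_j=0}(1\oplus|\zeta_j|)\big)$ (for $n=2$ with two triggers: $(|\zeta_1|\otimes(1\oplus|\zeta_2|))\oplus(|\zeta_2|\otimes(1\oplus|\zeta_1|))$). Two connectors are equivalent, $\zeta_1\equiv\zeta_2$, iff $|\zeta_1|\equiv|\zeta_2|$ in $wAI(P)$. $\overline{\zeta}$ is the class of $\zeta$ in $wAC(P)/\equiv$, with $\overline{\zeta_1}\oplus\overline{\zeta_2}=\overline{\zeta_1\oplus\zeta_2}$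 and $\overline{[\zeta_1]^\alpha}\otimes\overline{[\zeta_2]^\beta}=\overline{[\zeta_1]^\alpha\otimes[\zeta_2]^\beta}$ (well defined). -}

module Defs where

open import Level using (_⊔_)
open import Data.Nat using (ℕ; zero; suc)
open import Data.Bool using (Bool; true; false; if_then_else_; _∧_; _∨_)
open import Data.Fin using (Fin)
open import Data.Fin.Subset using (Subset; ⊥; _∪_)
open import Data.List using (List; []; _∷_; filter; map; concatMap)
open import Data.Bool.ListAction using (any)
open import Data.List.NonEmpty using (List⁺; _∷_)
open import Data.Vec using (Vec; []; _∷_; lookup)
open import Data.Vec.Properties using (≡-dec)
open import Data.Product using (_×_; _,_; proj₁; proj₂)
open import Relation.Nullary using (does)
open import Algebra.Bundles using (CommutativeSemiring)
import Data.Bool.Properties as BoolP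

-- Ports: P = Fin n (the paper requires P finite and nonempty; the
-- statement uses n = suc m).  Interactions are subsets of P
-- (Data.Fin.Subset), and γ ∈ Γ(P) = 2^(2^P) is given by its
-- characteristic function  Subset n → Bool.

Γ : ℕ → Set
Γ n = Subset n → Bool

allSubsets : (n : ℕ) → List (Subset n)
allSubsets zero    = [] ∷ []
allSubsets (suc n) = concatMap (λ a → (true ∷ a) ∷ (false ∷ a) ∷ []) (allSubsets n)

_≟S_ : ∀ {n} (a b : Subset n) → Bool
a ≟S b = does (≡-dec BoolP._≟_ a b)

⟨_⟩ : ∀ {n} → Subset n → Γ n
⟨ a ⟩ b = b ≟S a

infixl 6 _⊕_
infixl 7 _⊗_

data wAI (n : ℕ) : Set where
  𝟘 𝟙 : wAI n
  port : Fin n → wAI n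
  _⊕_ _⊗_ : wAI n → wAI n → wAI n
  ⦅_⦆ : wAI n → wAI n

-- Syntax of wAC(P)
--   Body  : what may stand inside brackets: 0, 1, p, or a connector ζ
--   Typed : [b] (α = false, synchron) or [b]' (α = true, trigger)
--   Conn  : ζ ::= typed connector | ζ ⊕ ζ | weighted fusion of ≥ 2 typed
--           connectors  [ζ₁]^α₁ ⊗ ⋯ ⊗ [ζₙ]^αₙ

mutual
  data Body (n : ℕ) : Set where
    b0 b1 : Body n
    bp    : Fin n → Body n
    bc    : Conn n → Body n

  data Typed (n : ℕ) : Set where
    [_]^_ : Body n → Bool → Typed n

  data Conn (n : ℕ) : Set where
    typed : Typed n → Conn n
    _⊕c_  : Conn n → Conn n → Conn n
    fuse  : Typed n → List⁺ (Typed n) → Conn n   -- t₁ ⊗ t₂ ⊗ ⋯ ⊗ tₙ, n ≥ 2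

infixl 7 _⊗c_
_⊗c_ : ∀ {n} → Typed n → Typed n → Conn n
t ⊗c u = fuse t (u ∷ [])

module _ {n : ℕ} where

  ⨁ : List (wAI n) → wAI n
  ⨁ []           = 𝟘
  ⨁ (x ∷ [])     = x
  ⨁ (x ∷ y ∷ xs) = x ⊕ ⨁ (y ∷ xs)

  ⨂ : List (wAI n) → wAI n
  ⨂ []           = 𝟙
  ⨂ (x ∷ [])     = x
  ⨂ (x ∷ y ∷ xs) = x ⊗ ⨂ (y ∷ xs)

  picks : ∀ {A : Set} → List A → List (A × List A)
  picks []       = []
  picks (x ∷ xs) = (x , xs) ∷ map (λ { (y , ys) → (y , x ∷ ys) }) (picks xs)

  isTrig : wAI n × Bool → Bool
  isTrig = proj₂

  notTrig : wAI n × Bool → Bool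
  notTrig (_ , α) = if α then false else true

  -- |[ζ₁]^α₁ ⊗ ⋯ ⊗ [ζₙ]^αₙ| given the list of (|ζᵢ|, αᵢ)
  fusionSem : List (wAI n × Bool) → wAI n
  fusionSem xs =
    if any isTrig xs
    then ⨁ (map (λ { ((z , _) , rest) →
                      z ⊗ ⨂ (map (λ u → 𝟙 ⊕ proj₁ u) (filter (λ u → Data.Bool.T? (isTrig u)) rest))
                        ⊗ ⨂ (map (λ u → 𝟙 ⊕ proj₁ u) (filter (λ u → Data.Bool.T? (notTrig u)) rest)) })
                (filter (λ p → Data.Bool.T? (isTrig (proj₁ p))) (picks xs)))
    else ⨂ (map proj₁ xs)

  mutual
    ∣_∣b : Body n → wAI n
    ∣ b0 ∣b   = 𝟘
    ∣ b1 ∣b   = 𝟙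
    ∣ bp p ∣b = port p
    ∣ bc ζ ∣b = ∣ ζ ∣

    ∣_∣t : Typed n → wAI n × Bool
    ∣ [ b ]^ α ∣t = ∣ b ∣b , α

    ∣_∣ts : List (Typed n) → List (wAI n × Bool)
    ∣ [] ∣ts     = []
    ∣ t ∷ ts ∣ts = ∣ t ∣t ∷ ∣ ts ∣ts

    ∣_∣ : Conn n → wAI n
    ∣ typed t ∣       = proj₁ ∣ t ∣t
    ∣ ζ₁ ⊕c ζ₂ ∣      = ∣ ζ₁ ∣ ⊕ ∣ ζ₂ ∣
    ∣ fuse t (u ∷ us) ∣ = fusionSem (∣ t ∣t ∷ ∣ u ∣t ∷ ∣ us ∣ts)

module Semantics {c ℓ} (K : CommutativeSemiring c ℓ) {n : ℕ} (k : Fin n → CommutativeSemiring.Carrier K) where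
  open CommutativeSemiring K renaming (_+_ to _⊞_; _*_ to _⊠_; 0# to 0̂; 1# to 1̂)

  Σ : List Carrier → Carrier
  Σ []       = 0̂
  Σ (x ∷ xs) = x ⊞ Σ xs

  elems : Γ n → List (Subset n)
  elems γ = filter (λ a → Data.Bool.T? (γ a)) (allSubsets n)

  splits : Subset n → List (Subset n × Subset n)
  splits a = filter (λ q → Data.Bool.T? ((proj₁ q ∪ proj₂ q) ≟S a))
                    (concatMap (λ a₁ → map (λ a₂ → a₁ , a₂) (allSubsets n)) (allSubsets n))

  ‖_‖ : wAI n → Γ n → Carrier
  ‖ 𝟘 ‖ γ        = 0̂
  ‖ 𝟙 ‖ γ        = if γ ⊥ then 1̂ else 0̂
  ‖ port p ‖ γ   = if any (λ a → lookup a p) (elems γ) then k p else 0̂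
  ‖ z₁ ⊕ z₂ ‖ γ  = Σ (map (λ a → ‖ z₁ ‖ ⟨ a ⟩ ⊞ ‖ z₂ ‖ ⟨ a ⟩) (elems γ))
  ‖ z₁ ⊗ z₂ ‖ γ  = Σ (map (λ a → Σ (map (λ q → ‖ z₁ ‖ ⟨ proj₁ q ⟩ ⊠ ‖ z₂ ‖ ⟨ proj₂ q ⟩) (splits a))) (elems γ))
  ‖ ⦅ z ⦆ ‖ γ    = ‖ z ‖ γ

  _≡I_ : wAI n → wAI n → Set ℓ
  z₁ ≡I z₂ = ∀ (γ : Γ n) → ‖ z₁ ‖ γ ≈ ‖ z₂ ‖ γ

  infix 4 _≡I_ _≡C_

  _≡C_ : Conn n → Conn n → Set ℓ
  ζ₁ ≡C ζ₂ = ∣ ζ₁ ∣ ≡I ∣ ζ₂ ∣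

AddIdempotent : ∀ {c ℓ} → CommutativeSemiring c ℓ → Set (c ⊔ ℓ)
AddIdempotent K = ∀ x → x + x ≈ x
  where open CommutativeSemiring K

{-# OPTIONS --safe #-}
-- The connector [1] denotes the interaction 1, whose value on a singleton {b} is the
-- indicator of b = ∅.  Since ‖z‖ γ = ⊕_{a ∈ γ} ‖z‖ {a} (for ports this uses idempotence
-- of ⊕), a fusion z ⊗ 1 is evaluated split by split, and among the splits a₁ ∪ a₂ = a
-- only (a , ∅) survives: so 1 is a two-sided unit for ⊗.  Fusing with a synchron [1]
-- gives |ζ| ⊗ 1 (or 1 ⊗ |ζ|); when [ζ]' is a trigger both orders give
-- (|ζ| ⊗ 1) ⊗ (1 ⊕ 1), and 1 ⊕ 1 ≡ 1 by idempotence.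
module Submission where

open import Defs
open import Data.Nat using (ℕ; suc; zero)
open import Data.Bool using (Bool; false; true; if_then_else_; T?)
import Data.Bool.Properties as Bool
open import Data.Bool.ListAction using (any)
open import Data.Fin using (Fin)
open import Data.Fin.Subset using (Subset; ⊥; _∪_)
open import Data.Fin.Subset.Properties using (∪-identityˡ; ∪-identityʳ)
open import Data.Product using (_×_; _,_; proj₁; proj₂)
open import Data.List using (List; []; _∷_; filter; map; concatMap; _++_)
open import Data.List.Properties using (map-++; map-∘)
open import Data.Vec using ([]; _∷_; lookup)
open import Data.Vec.Properties using (≡-dec)
open import Function using (_∘_)
open import Relation.Nullary using (¬_; yes; no; contradiction)
open import Relation.Nullary.Decidable using (dec-true)
open import Relation.Binary.Bundles using (Setoid)
open import Relation.Binary.PropositionalEquality as ≡ using (_≡_; _≢_; cong; cong₂)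
open import Algebra.Bundles using (CommutativeSemiring)
import Relation.Binary.Reasoning.Setoid as SetoidReasoning

≟S-refl : ∀ {n} (a : Subset n) → (a ≟S a) ≡ true
≟S-refl a = dec-true (≡-dec Bool._≟_ a a) ≡.refl

filter-≟S-allSubsets : ∀ n (a : Subset n) → filter (λ b → T? (b ≟S a)) (allSubsets n) ≡ a ∷ []
filter-≟S-allSubsets zero    []      = ≡.refl
filter-≟S-allSubsets (suc n) (x ∷ a) =
  ≡.trans (filter-≟S-extend x (allSubsets n)) (cong (map (x ∷_)) (filter-≟S-allSubsets n a))
  where
  filter-≟S-extend : ∀ x (l : List (Subset n)) →
    filter (λ b → T? (b ≟S (x ∷ a))) (concatMap (λ b → (true ∷ b) ∷ (false ∷ b) ∷ []) l)
    ≡ map (x ∷_) (filter (λ b → T? (b ≟S a)) l)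
  filter-≟S-extend x     []      = ≡.refl
  filter-≟S-extend true  (b ∷ l) with ≡-dec Bool._≟_ b a
  ... | yes _ = cong (_ ∷_) (filter-≟S-extend true l)
  ... | no  _ = filter-≟S-extend true l
  filter-≟S-extend false (b ∷ l) with ≡-dec Bool._≟_ b a
  ... | yes _ = cong (_ ∷_) (filter-≟S-extend false l)
  ... | no  _ = filter-≟S-extend false l

module Properties {c ℓ} (K : CommutativeSemiring c ℓ) {n : ℕ}
                  (k : Fin n → CommutativeSemiring.Carrier K) where
  open CommutativeSemiring K
  open Semantics K k
  open SetoidReasoning setoid

  ∅ : Subset n
  ∅ = ⊥

  elems-⟨⟩ : (a : Subset n) → elems ⟨ a ⟩ ≡ a ∷ []
  elems-⟨⟩ = filter-≟S-allSubsets n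

  if-zero : ∀ v {x} → x ≈ 0# → (if v then x else 0#) ≈ 0#
  if-zero true  x≈0 = x≈0
  if-zero false _   = refl

  Σ-cong : ∀ {A : Set} {f g : A → Carrier} (l : List A) →
           (∀ x → f x ≈ g x) → Σ (map f l) ≈ Σ (map g l)
  Σ-cong []      f≈g = refl
  Σ-cong (x ∷ l) f≈g = +-cong (f≈g x) (Σ-cong l f≈g)

  Σ-zero : ∀ {A : Set} {f : A → Carrier} (l : List A) → (∀ x → f x ≈ 0#) → Σ (map f l) ≈ 0#
  Σ-zero []      f≈0 = refl
  Σ-zero (x ∷ l) f≈0 = trans (+-cong (f≈0 x) (Σ-zero l f≈0)) (+-identityˡ 0#)

  Σ-++ : (xs ys : List Carrier) → Σ (xs ++ ys) ≈ Σ xs + Σ ys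
  Σ-++ []       ys = sym (+-identityˡ _)
  Σ-++ (x ∷ xs) ys = trans (+-cong refl (Σ-++ xs ys)) (sym (+-assoc _ _ _))

  Σ-concatMap : ∀ {A B : Set} (f : B → Carrier) (g : A → List B) (l : List A) →
                Σ (map f (concatMap g l)) ≈ Σ (map (λ x → Σ (map f (g x))) l)
  Σ-concatMap f g []      = refl
  Σ-concatMap f g (x ∷ l) = begin
    Σ (map f (g x ++ concatMap g l))             ≡⟨ cong Σ (map-++ f (g x) (concatMap g l)) ⟩
    Σ (map f (g x) ++ map f (concatMap g l))     ≈⟨ Σ-++ (map f (g x)) (map f (concatMap g l)) ⟩
    Σ (map f (g x)) + Σ (map f (concatMap g l))  ≈⟨ +-cong refl (Σ-concatMap f g l) ⟩
    Σ (map (λ x → Σ (map f (g x))) (x ∷ l))      ∎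

  Σ-filter : ∀ {A : Set} (f : A → Carrier) (P : A → Bool) (l : List A) →
    Σ (map f (filter (λ a → T? (P a)) l)) ≈ Σ (map (λ a → if P a then f a else 0#) l)
  Σ-filter f P []      = refl
  Σ-filter f P (x ∷ l) with P x
  ... | true  = +-cong refl (Σ-filter f P l)
  ... | false = trans (Σ-filter f P l) (sym (+-identityˡ _))

  Σ-any : AddIdempotent K → (h : Subset n → Bool) (x : Carrier) (l : List (Subset n)) →
          Σ (map (λ a → if h a then x else 0#) l) ≈ (if any h l then x else 0#)
  Σ-any idem h x []      = refl
  Σ-any idem h x (a ∷ l) with h a
  ... | false = trans (+-identityˡ _) (Σ-any idem h x l)
  ... | true with any h l | Σ-any idem h x l
  ...   | true  | ih = trans (+-cong refl ih) (idem x)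
  ...   | false | ih = trans (+-cong refl ih) (+-identityʳ x)

  Σ-elems-⟨⟩ : (f : Subset n → Carrier) (a : Subset n) → Σ (map f (elems ⟨ a ⟩)) ≈ f a
  Σ-elems-⟨⟩ f a rewrite elems-⟨⟩ a = +-identityʳ (f a)

  Σ-allSubsets-point : (g : Subset n → Carrier) (t : Subset n) →
    (∀ b → b ≢ t → g b ≈ 0#) → Σ (map g (allSubsets n)) ≈ g t
  Σ-allSubsets-point g t g≈0 = begin
    Σ (map g (allSubsets n))                                     ≈⟨ Σ-cong (allSubsets n) restrict ⟩
    Σ (map (λ b → if ⟨ t ⟩ b then g b else 0#) (allSubsets n))  ≈⟨ Σ-filter g ⟨ t ⟩ (allSubsets n) ⟨
    Σ (map g (elems ⟨ t ⟩))                                      ≈⟨ Σ-elems-⟨⟩ g t ⟩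
    g t                                                          ∎
    where
    restrict : ∀ b → g b ≈ (if ⟨ t ⟩ b then g b else 0#)
    restrict b with ≡-dec Bool._≟_ b t
    ... | yes _   = refl
    ... | no  b≢t = g≈0 b b≢t

  Σ-allSubsets²-point : (G : Subset n → Subset n → Carrier) (s t : Subset n) →
    (∀ a₁ a₂ → ¬ (a₁ ≡ s × a₂ ≡ t) → G a₁ a₂ ≈ 0#) →
    Σ (map (λ a₁ → Σ (map (G a₁) (allSubsets n))) (allSubsets n)) ≈ G s t
  Σ-allSubsets²-point G s t G≈0 = begin
    Σ (map (λ a₁ → Σ (map (G a₁) (allSubsets n))) (allSubsets n))
      ≈⟨ Σ-allSubsets-point _ s (λ a₁ a₁≢s → Σ-zero (allSubsets n) (λ a₂ → G≈0 a₁ a₂ (a₁≢s ∘ proj₁))) ⟩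
    Σ (map (G s) (allSubsets n))
      ≈⟨ Σ-allSubsets-point (G s) t (λ a₂ a₂≢t → G≈0 s a₂ (a₂≢t ∘ proj₂)) ⟩
    G s t ∎

  Σ-splits : (F : Subset n → Subset n → Carrier) (a : Subset n) →
    Σ (map (λ q → F (proj₁ q) (proj₂ q)) (splits a)) ≈
    Σ (map (λ a₁ → Σ (map (λ a₂ → if (a₁ ∪ a₂) ≟S a then F a₁ a₂ else 0#) (allSubsets n)))
           (allSubsets n))
  Σ-splits F a = begin
    Σ (map (λ q → F (proj₁ q) (proj₂ q)) (splits a))
      ≈⟨ Σ-filter (λ q → F (proj₁ q) (proj₂ q)) (λ q → (proj₁ q ∪ proj₂ q) ≟S a) pairs ⟩
    Σ (map G pairs)
      ≈⟨ Σ-concatMap G (λ a₁ → map (a₁ ,_) (allSubsets n)) (allSubsets n) ⟩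
    Σ (map (λ a₁ → Σ (map G (map (a₁ ,_) (allSubsets n)))) (allSubsets n))
      ≈⟨ Σ-cong (allSubsets n) (λ a₁ → reflexive (cong Σ (≡.sym (map-∘ (allSubsets n))))) ⟩
    Σ (map (λ a₁ → Σ (map (λ a₂ → G (a₁ , a₂)) (allSubsets n))) (allSubsets n)) ∎
    where
    pairs : List (Subset n × Subset n)
    pairs = concatMap (λ a₁ → map (a₁ ,_) (allSubsets n)) (allSubsets n)

    G : Subset n × Subset n → Carrier
    G q = if (proj₁ q ∪ proj₂ q) ≟S a then F (proj₁ q) (proj₂ q) else 0#

  ‖‖-singletons : AddIdempotent K → ∀ z γ → ‖ z ‖ γ ≈ Σ (map (λ a → ‖ z ‖ ⟨ a ⟩) (elems γ))
  ‖‖-singletons idem 𝟘 γ = sym (Σ-zero (elems γ) (λ _ → refl))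
  ‖‖-singletons idem 𝟙 γ = sym (begin
    Σ (map (λ a → ‖ 𝟙 ‖ ⟨ a ⟩) (elems γ))
      ≈⟨ Σ-filter _ γ (allSubsets n) ⟩
    Σ (map (λ a → if γ a then ‖ 𝟙 ‖ ⟨ a ⟩ else 0#) (allSubsets n))
      ≈⟨ Σ-allSubsets-point _ ∅ off-∅ ⟩
    (if γ ∅ then (if ∅ ≟S ∅ then 1# else 0#) else 0#)
      ≡⟨ cong (λ v → if γ ∅ then (if v then 1# else 0#) else 0#) (≟S-refl ∅) ⟩
    ‖ 𝟙 ‖ γ ∎)
    where
    off-∅ : ∀ b → b ≢ ∅ → (if γ b then ‖ 𝟙 ‖ ⟨ b ⟩ else 0#) ≈ 0#
    off-∅ b b≢∅ with ≡-dec Bool._≟_ ∅ b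
    ... | yes ∅≡b = contradiction (≡.sym ∅≡b) b≢∅
    ... | no  _   = if-zero (γ b) refl
  ‖‖-singletons idem (port p) γ = sym (begin
    Σ (map (λ a → ‖ port p ‖ ⟨ a ⟩) (elems γ))
      ≈⟨ Σ-cong (elems γ) port-⟨⟩ ⟩
    Σ (map (λ a → if lookup a p then k p else 0#) (elems γ))
      ≈⟨ Σ-any idem (λ a → lookup a p) (k p) (elems γ) ⟩
    ‖ port p ‖ γ ∎)
    where
    port-⟨⟩ : ∀ a → ‖ port p ‖ ⟨ a ⟩ ≈ (if lookup a p then k p else 0#)
    port-⟨⟩ a rewrite elems-⟨⟩ a with lookup a p
    ... | true  = refl
    ... | false = refl
  ‖‖-singletons idem (z₁ ⊕ z₂) γ =
    Σ-cong (elems γ) (λ a → sym (Σ-elems-⟨⟩ (λ b → ‖ z₁ ‖ ⟨ b ⟩ + ‖ z₂ ‖ ⟨ b ⟩) a))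
  ‖‖-singletons idem (z₁ ⊗ z₂) γ =
    Σ-cong (elems γ) (λ a → sym (Σ-elems-⟨⟩ (λ b → Σ (map (λ q → ‖ z₁ ‖ ⟨ proj₁ q ⟩ * ‖ z₂ ‖ ⟨ proj₂ q ⟩) (splits b))) a))
  ‖‖-singletons idem ⦅ z ⦆ γ = ‖‖-singletons idem z γ

  ≡I-setoid : Setoid _ _
  ≡I-setoid = record
    { Carrier       = wAI n
    ; _≈_           = _≡I_
    ; isEquivalence = record
      { refl  = λ γ → refl
      ; sym   = λ z₁≡z₂ γ → sym (z₁≡z₂ γ)
      ; trans = λ z₁≡z₂ z₂≡z₃ γ → trans (z₁≡z₂ γ) (z₂≡z₃ γ)
      }
    }

  ⊗-congˡ : ∀ z₁ z₂ z₂′ → z₂ ≡I z₂′ → z₁ ⊗ z₂ ≡I z₁ ⊗ z₂′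
  ⊗-congˡ z₁ z₂ z₂′ z₂≡z₂′ γ =
    Σ-cong (elems γ) (λ a → Σ-cong (splits a) (λ q → *-cong refl (z₂≡z₂′ ⟨ proj₂ q ⟩)))

  ⊕-idem : AddIdempotent K → ∀ z → z ⊕ z ≡I z
  ⊕-idem idem z γ =
    trans (Σ-cong (elems γ) (λ a → idem (‖ z ‖ ⟨ a ⟩))) (sym (‖‖-singletons idem z γ))

  ⊗-identityʳ : AddIdempotent K → ∀ z → z ⊗ 𝟙 ≡I z
  ⊗-identityʳ idem z γ =
    trans (Σ-cong (elems γ) split-at-∅) (sym (‖‖-singletons idem z γ))
    where
    split-at-∅ : ∀ a → Σ (map (λ q → ‖ z ‖ ⟨ proj₁ q ⟩ * ‖ 𝟙 ‖ ⟨ proj₂ q ⟩) (splits a)) ≈ ‖ z ‖ ⟨ a ⟩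
    split-at-∅ a = begin
      Σ (map (λ q → ‖ z ‖ ⟨ proj₁ q ⟩ * ‖ 𝟙 ‖ ⟨ proj₂ q ⟩) (splits a))
        ≈⟨ Σ-splits (λ a₁ a₂ → ‖ z ‖ ⟨ a₁ ⟩ * ‖ 𝟙 ‖ ⟨ a₂ ⟩) a ⟩
      _ ≈⟨ Σ-allSubsets²-point _ a ∅ vanishes ⟩
      (if (a ∪ ∅) ≟S a then ‖ z ‖ ⟨ a ⟩ * ‖ 𝟙 ‖ ⟨ ∅ ⟩ else 0#)
        ≡⟨ cong (λ b → if b ≟S a then ‖ z ‖ ⟨ a ⟩ * ‖ 𝟙 ‖ ⟨ ∅ ⟩ else 0#) (∪-identityʳ a) ⟩
      (if a ≟S a then ‖ z ‖ ⟨ a ⟩ * ‖ 𝟙 ‖ ⟨ ∅ ⟩ else 0#)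
        ≡⟨ cong₂ (λ v w → if v then ‖ z ‖ ⟨ a ⟩ * (if w then 1# else 0#) else 0#) (≟S-refl a) (≟S-refl ∅) ⟩
      ‖ z ‖ ⟨ a ⟩ * 1#
        ≈⟨ *-identityʳ _ ⟩
      ‖ z ‖ ⟨ a ⟩ ∎
      where
      vanishes : ∀ a₁ a₂ → ¬ (a₁ ≡ a × a₂ ≡ ∅) →
        (if (a₁ ∪ a₂) ≟S a then ‖ z ‖ ⟨ a₁ ⟩ * ‖ 𝟙 ‖ ⟨ a₂ ⟩ else 0#) ≈ 0#
      vanishes a₁ a₂ ¬a,∅ with ≡-dec Bool._≟_ ∅ a₂
      ... | no _ = if-zero ((a₁ ∪ a₂) ≟S a) (zeroʳ _)
      ... | yes ≡.refl rewrite ∪-identityʳ a₁ with ≡-dec Bool._≟_ a₁ a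
      ...   | yes a₁≡a = contradiction (a₁≡a , ≡.refl) ¬a,∅
      ...   | no  _    = refl

  ⊗-identityˡ : AddIdempotent K → ∀ z → 𝟙 ⊗ z ≡I z
  ⊗-identityˡ idem z γ =
    trans (Σ-cong (elems γ) split-at-∅) (sym (‖‖-singletons idem z γ))
    where
    split-at-∅ : ∀ a → Σ (map (λ q → ‖ 𝟙 ‖ ⟨ proj₁ q ⟩ * ‖ z ‖ ⟨ proj₂ q ⟩) (splits a)) ≈ ‖ z ‖ ⟨ a ⟩
    split-at-∅ a = begin
      Σ (map (λ q → ‖ 𝟙 ‖ ⟨ proj₁ q ⟩ * ‖ z ‖ ⟨ proj₂ q ⟩) (splits a))
        ≈⟨ Σ-splits (λ a₁ a₂ → ‖ 𝟙 ‖ ⟨ a₁ ⟩ * ‖ z ‖ ⟨ a₂ ⟩) a ⟩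
      _ ≈⟨ Σ-allSubsets²-point _ ∅ a vanishes ⟩
      (if (∅ ∪ a) ≟S a then ‖ 𝟙 ‖ ⟨ ∅ ⟩ * ‖ z ‖ ⟨ a ⟩ else 0#)
        ≡⟨ cong (λ b → if b ≟S a then ‖ 𝟙 ‖ ⟨ ∅ ⟩ * ‖ z ‖ ⟨ a ⟩ else 0#) (∪-identityˡ a) ⟩
      (if a ≟S a then ‖ 𝟙 ‖ ⟨ ∅ ⟩ * ‖ z ‖ ⟨ a ⟩ else 0#)
        ≡⟨ cong₂ (λ v w → if v then (if w then 1# else 0#) * ‖ z ‖ ⟨ a ⟩ else 0#) (≟S-refl a) (≟S-refl ∅) ⟩
      1# * ‖ z ‖ ⟨ a ⟩
        ≈⟨ *-identityˡ _ ⟩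
      ‖ z ‖ ⟨ a ⟩ ∎
      where
      vanishes : ∀ a₁ a₂ → ¬ (a₁ ≡ ∅ × a₂ ≡ a) →
        (if (a₁ ∪ a₂) ≟S a then ‖ 𝟙 ‖ ⟨ a₁ ⟩ * ‖ z ‖ ⟨ a₂ ⟩ else 0#) ≈ 0#
      vanishes a₁ a₂ ¬∅,a with ≡-dec Bool._≟_ ∅ a₁
      ... | no _ = if-zero ((a₁ ∪ a₂) ≟S a) (zeroˡ _)
      ... | yes ≡.refl rewrite ∪-identityˡ a₂ with ≡-dec Bool._≟_ a₂ a
      ...   | yes a₂≡a = contradiction (≡.refl , a₂≡a) ¬∅,a
      ...   | no  _    = refl

proposition2 : ∀ {c ℓ} (K : CommutativeSemiring c ℓ) → AddIdempotent K →
    (m : ℕ) (k : Fin (suc m) → CommutativeSemiring.Carrier K) →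
    (ζ₁ : Conn (suc m)) (α : Bool) →
    let open Semantics K k in
    (([ bc ζ₁ ]^ α) ⊗c ([ b1 ]^ false) ≡C typed ([ bc ζ₁ ]^ α))
    × (typed ([ bc ζ₁ ]^ α) ≡C ([ b1 ]^ false) ⊗c ([ bc ζ₁ ]^ α))
proposition2 K idem m k ζ₁ false =
  ⊗-identityʳ idem ∣ ζ₁ ∣ , λ γ → sym (⊗-identityˡ idem ∣ ζ₁ ∣ γ)
  where open CommutativeSemiring K using (sym)
        open Properties K k
proposition2 K idem m k ζ₁ true = trigger-fusion , λ γ → sym (trigger-fusion γ)
  where
  open CommutativeSemiring K using (sym)
  open Properties K k
  open Semantics K k using (_≡I_)
  open SetoidReasoning ≡I-setoid

  trigger-fusion : (∣ ζ₁ ∣ ⊗ 𝟙) ⊗ (𝟙 ⊕ 𝟙) ≡I ∣ ζ₁ ∣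
  trigger-fusion = begin
    (∣ ζ₁ ∣ ⊗ 𝟙) ⊗ (𝟙 ⊕ 𝟙) ≈⟨ ⊗-congˡ (∣ ζ₁ ∣ ⊗ 𝟙) (𝟙 ⊕ 𝟙) 𝟙 (⊕-idem idem 𝟙) ⟩
    (∣ ζ₁ ∣ ⊗ 𝟙) ⊗ 𝟙       ≈⟨ ⊗-identityʳ idem (∣ ζ₁ ∣ ⊗ 𝟙) ⟩
    ∣ ζ₁ ∣ ⊗ 𝟙             ≈⟨ ⊗-identityʳ idem ∣ ζ₁ ∣ ⟩
    ∣ ζ₁ ∣                 ∎
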